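{- For $n\ge 1$, $$CGVSP(n)=\begin{cases}0&\text{if } n=1,\\2&\text{if } n=2,\\1&\text{otherwise,}\end{cases}\qquad CGVSP(n,t)=\begin{cases}1&\text{if } t=1,\ n=2,\\1&\text{if } t=2,\ n\ge 2,\\0&\text{otherwise.}\end{cases}$$
   Context: A simple game is a pair $(N,W)$ with $N=\{1,\dots,n\}$ and $W$ a family of subsets of $N$ (the winning coalitions) such that $N\in W$, $\emptyset\notin W$, and $S\in W$, $S\subseteq T\subseteq N$ imply $T\in W$. Players $i,j$ are equally desirable ($i\approx j$) if $S\cup\{i\}\in W\iff S\cup\{j\}\in W$ for all $S\subseteq N\setminus\{i,j\}$; $i\succsim j$ if $S\cup\{j\}\in W\Rightarrow S\cup\{i\}\in W$ for all $S\subseteq N\setminus\{i,j\}$. The game is complete if $\succsim$ is a complete preorder. The number of types $t$ is the number of equivalence classes of $\approx$. Player $i$ has veto if $i\in S$ for all $S\in W$; player $i$ is a semi-passer if $\{i\}\notin W$ and $\{i,j\}\in W$ for all $j\in N\setminus\{i\}$. $CGVSP(n)$ is the number of isomorphism classes (isomorphism = bijection of players preserving winning coalitions) of complete simple games with $n$ players containing at least one vetoer and at least one semi-passer (both roles may be taken by the same player); $CGVSP(n,t)$ is the number of those with exactly $t$ types. -}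

module Defs where

open import Data.Nat using (ℕ; zero; suc)
open import Data.Bool using (Bool; true; false)
open import Data.Fin using (Fin)
open import Data.Fin.Subset using (Subset; ⊤; ⊥; ⁅_⁆; _∪_; _∈_; _∉_; _⊆_)
open import Data.Fin.Permutation using (Permutation′; _⟨$⟩ʳ_)
open import Data.Vec using (Vec; lookup; tabulate)
open import Data.Vec.Relation.Unary.All using (All)
open import Data.Product using (Σ; ∃; _×_)
open import Data.Sum using (_⊎_)
open import Relation.Binary.PropositionalEquality using (_≡_; _≢_)
open import Relation.Nullary using (¬_)
open import Function.Bundles using (_⇔_)

-- A (candidate) game on n players: the characteristic function of W,
-- a Boolean predicate on coalitions (subsets of Fin n).
Game : ℕ → Set
Game n = Subset n → Bool

module _ {n : ℕ} (G : Game n) where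

  Winning : Subset n → Set
  Winning S = G S ≡ true

  IsSimpleGame : Set
  IsSimpleGame = Winning ⊤ × ¬ Winning ⊥
               × (∀ S T → S ⊆ T → Winning S → Winning T)

  _≿_ : Fin n → Fin n → Set
  i ≿ j = ∀ S → i ∉ S → j ∉ S → Winning (S ∪ ⁅ j ⁆) → Winning (S ∪ ⁅ i ⁆)

  _≈_ : Fin n → Fin n → Set
  i ≈ j = ∀ S → i ∉ S → j ∉ S → (Winning (S ∪ ⁅ i ⁆) ⇔ Winning (S ∪ ⁅ j ⁆))

  -- ≿ is complete (it is always a preorder)
  Complete : Set
  Complete = ∀ i j → (i ≿ j) ⊎ (j ≿ i)

  -- the relation ≈ has exactly t equivalence classes: there is a surjection
  -- Fin n → Fin t whose fibres are exactly the ≈-classes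
  HasTypes : ℕ → Set
  HasTypes t = Σ (Fin n → Fin t) λ f →
                 (∀ k → ∃ λ i → f i ≡ k) × (∀ i j → (f i ≡ f j) ⇔ (i ≈ j))

  Vetoer : Fin n → Set
  Vetoer i = ∀ S → Winning S → i ∈ S

  SemiPasser : Fin n → Set
  SemiPasser i = ¬ Winning ⁅ i ⁆ × (∀ j → j ≢ i → Winning (⁅ i ⁆ ∪ ⁅ j ⁆))

  IsCGVSP : Set
  IsCGVSP = IsSimpleGame × Complete × (∃ λ i → Vetoer i) × (∃ λ j → SemiPasser j)

-- image of a coalition under a bijection of players (j ∈ σ(S) iff σ⁻¹ j ∈ S)
image : ∀ {n} → Permutation′ n → Subset n → Subset n
image σ S = tabulate λ i → lookup S (σ ⟨$⟩ʳ i)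

Iso : ∀ {n} → Game n → Game n → Set
Iso {n} G H = Σ (Permutation′ n) λ σ → ∀ S → G S ≡ H (image σ S)

NumIsoClasses : (n : ℕ) → (Game n → Set) → ℕ → Set
NumIsoClasses n P k =
  Σ (Vec (Game n) k) λ gs →
    All P gs
    × (∀ a b → a ≢ b → ¬ Iso (lookup gs a) (lookup gs b))
    × (∀ G → P G → ∃ λ a → Iso G (lookup gs a))

cgvsp : ℕ → ℕ
cgvsp 1 = 0
cgvsp 2 = 2
cgvsp _ = 1

cgvspT : ℕ → ℕ → ℕ
cgvspT 2 1 = 1
cgvspT zero _ = 0
cgvspT (suc zero) _ = 0
cgvspT (suc (suc _)) 2 = 1
cgvspT _ _ = 0

-- Let i have veto and j be a semi-passer. Every pair {j, k} wins, so contains i; a third player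
-- k ∉ {i, j} therefore forces i = j. A player who is both vetoer and semi-passer determines the
-- game: the winning coalitions are those containing i and at least one other player. Hence for
-- n ≥ 3 there is exactly one game, and it has two types ({i} and everybody else). With only two
-- players the vetoer may instead be a dictator (the other player is then a semi-passer), which adds
-- a second game with two types; the two-player veto-pair game is unanimity and has a single type.
-- With one player, {1} = N wins, so there is no semi-passer.
module Submission where

open import Defs
open import Data.Bool using (true)
open import Data.Bool.Properties using (⇔→≡) renaming (_≟_ to _≟ᵇ_)
open import Data.Empty using (⊥-elim)
open import Data.Fin using (Fin; zero; suc; _≟_; punchIn)
open import Data.Fin.Properties using (any?; punchInᵢ≢i; ¬Fin0)
open import Data.Fin.Subset using (⊤; ⊥; ⁅_⁆; _∪_; _∈_; _∉_; _⊆_)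
open import Data.Fin.Subset.Properties
  using (_∈?_; ∉⊥; ∈⊤; x∈⁅x⁆; x∈⁅y⁆⇒x≡y; x≢y⇒x∉⁅y⁆; p⊆p∪q; q⊆p∪q; x∈p∪q⁻)
open import Data.Fin.Permutation
  using (Permutation′; _⟨$⟩ʳ_; _⟨$⟩ˡ_; inverseˡ; inverseʳ; transpose; flip; permutation; ↔⇒≡)
open import Data.Nat using (ℕ; zero; suc; _+_; _≥_)
open import Data.Product using (_×_; _,_; proj₁; proj₂; ∃)
open import Data.Sum using (_⊎_; inj₁; inj₂; [_,_]′)
open import Data.Vec using (Vec; []; _∷_; lookup; tabulate)
open import Data.Vec.Properties
  using (lookup∘tabulate; tabulate∘lookup; tabulate-cong; []=⇒lookup; lookup⇒[]=)
open import Data.Vec.Relation.Unary.All using ([]; _∷_)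
open import Function.Base using (_∘_)
open import Function.Bundles using (_⇔_; mk⇔; Equivalence)
open import Relation.Binary.PropositionalEquality
  using (_≡_; _≢_; refl; sym; trans; cong; subst; module ≡-Reasoning)
open import Relation.Nullary using (¬_; Dec; yes; no; does; contradiction)
open import Relation.Nullary.Decidable using (¬?; _×-dec_; dec-true)

open Equivalence using (to; from)

another : ∀ {m} (i : Fin (suc (suc m))) → ∃ λ j → j ≢ i
another i = punchIn i zero , punchInᵢ≢i i zero

aThird : ∀ {m} (i j : Fin (3 + m)) → ∃ λ k → k ≢ i × k ≢ j
aThird zero          zero          = suc zero , (λ ()) , (λ ())
aThird zero          (suc zero)    = suc (suc zero) , (λ ()) , (λ ())
aThird zero          (suc (suc j)) = suc zero , (λ ()) , (λ ())
aThird (suc zero)    zero          = suc (suc zero) , (λ ()) , (λ ())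
aThird (suc zero)    (suc j)       = zero , (λ ()) , (λ ())
aThird (suc (suc i)) zero          = suc zero , (λ ()) , (λ ())
aThird (suc (suc i)) (suc j)       = zero , (λ ()) , (λ ())

Fin2-≢-unique : ∀ {i j k : Fin 2} → j ≢ i → k ≢ i → j ≡ k
Fin2-≢-unique {zero}     {zero}                 j≢i _   = contradiction refl j≢i
Fin2-≢-unique {zero}     {suc zero} {zero}      _   k≢i = contradiction refl k≢i
Fin2-≢-unique {zero}     {suc zero} {suc zero}  _   _   = refl
Fin2-≢-unique {suc zero} {zero}     {zero}      _   _   = refl
Fin2-≢-unique {suc zero} {zero}     {suc zero}  _   k≢i = contradiction refl k≢i
Fin2-≢-unique {suc zero} {suc zero}             j≢i _   = contradiction refl j≢i

⁅⁆⊆ : ∀ {n} {i : Fin n} {S} → i ∈ S → ⁅ i ⁆ ⊆ S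
⁅⁆⊆ {i = i} {S} i∈S x∈⁅i⁆ = subst (_∈ S) (sym (x∈⁅y⁆⇒x≡y i x∈⁅i⁆)) i∈S

⁅⁆∪⁅⁆⊆ : ∀ {n} {i j : Fin n} {S} → i ∈ S → j ∈ S → ⁅ i ⁆ ∪ ⁅ j ⁆ ⊆ S
⁅⁆∪⁅⁆⊆ {i = i} {j} i∈S j∈S x∈ with x∈p∪q⁻ ⁅ i ⁆ ⁅ j ⁆ x∈
... | inj₁ x∈⁅i⁆ = ⁅⁆⊆ i∈S x∈⁅i⁆
... | inj₂ x∈⁅j⁆ = ⁅⁆⊆ j∈S x∈⁅j⁆

i∈⁅i⁆∪⁅j⁆ : ∀ {n} (i j : Fin n) → i ∈ ⁅ i ⁆ ∪ ⁅ j ⁆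
i∈⁅i⁆∪⁅j⁆ i j = p⊆p∪q ⁅ j ⁆ (x∈⁅x⁆ i)

j∈⁅i⁆∪⁅j⁆ : ∀ {n} (i j : Fin n) → j ∈ ⁅ i ⁆ ∪ ⁅ j ⁆
j∈⁅i⁆∪⁅j⁆ i j = q⊆p∪q ⁅ i ⁆ ⁅ j ⁆ (x∈⁅x⁆ j)

does≡true⇔ : ∀ {A : Set} (a? : Dec A) → does a? ≡ true ⇔ A
does≡true⇔ (yes a) = mk⇔ (λ _ → a) (λ _ → refl)
does≡true⇔ (no ¬a) = mk⇔ (λ ()) (λ a → contradiction a ¬a)

partner? : ∀ {n} (i : Fin n) S → Dec (∃ λ j → j ≢ i × j ∈ S)
partner? i S = any? (λ j → ¬? (j ≟ i) ×-dec (j ∈? S))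

surjections-same-kernel⇒≡ : ∀ {n t u} (f : Fin n → Fin t) (g : Fin n → Fin u) →
                            (∀ k → ∃ λ i → f i ≡ k) → (∀ k → ∃ λ i → g i ≡ k) →
                            (∀ i j → f i ≡ f j ⇔ g i ≡ g j) → t ≡ u
surjections-same-kernel⇒≡ f g f-onto g-onto kernel = ↔⇒≡ (permutation h h⁻¹ h∘h⁻¹ h⁻¹∘h)
  where
  h : _ → _
  h k = g (proj₁ (f-onto k))
  h⁻¹ : _ → _
  h⁻¹ k = f (proj₁ (g-onto k))
  h∘h⁻¹ : ∀ k → h (h⁻¹ k) ≡ k
  h∘h⁻¹ k = let (x , gx≡k) = g-onto k in trans (to (kernel _ x) (proj₂ (f-onto (f x)))) gx≡k
  h⁻¹∘h : ∀ k → h⁻¹ (h k) ≡ k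
  h⁻¹∘h k = let (x , fx≡k) = f-onto k in trans (from (kernel _ x) (proj₂ (g-onto (g x)))) fx≡k

module _ {n : ℕ} (G : Game n) where

  UpClosed : Set
  UpClosed = ∀ S T → S ⊆ T → Winning G S → Winning G T

  IsVetoPairGame : Fin n → Set
  IsVetoPairGame i = ∀ S → Winning G S ⇔ (i ∈ S × ∃ λ j → j ≢ i × j ∈ S)

  IsDictatorship : Fin n → Set
  IsDictatorship i = ∀ S → Winning G S ⇔ i ∈ S

  OthersInterchangeable : Fin n → Set
  OthersInterchangeable i = ∀ j k → j ≢ i → k ≢ i → _≿_ G j k

  ≈-refl : ∀ i → _≈_ G i i
  ≈-refl i S _ _ = mk⇔ (λ w → w) (λ w → w)

  ≈-sym : ∀ {i j} → _≈_ G i j → _≈_ G j i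
  ≈-sym i≈j S j∉S i∉S = mk⇔ (from (i≈j S i∉S j∉S)) (to (i≈j S i∉S j∉S))

  ≿-antisym : ∀ {i j} → _≿_ G i j → _≿_ G j i → _≈_ G i j
  ≿-antisym i≿j j≿i S i∉S j∉S = mk⇔ (j≿i S j∉S i∉S) (i≿j S i∉S j∉S)

  vetoer⇒≿ : ∀ {i} → Vetoer G i → ∀ j → _≿_ G i j
  vetoer⇒≿ {i} veto j S i∉S j∉S w with x∈p∪q⁻ S ⁅ j ⁆ (veto _ w)
  ... | inj₁ i∈S   = contradiction i∈S i∉S
  ... | inj₂ i∈⁅j⁆ = subst (λ x → Winning G (S ∪ ⁅ x ⁆)) (sym (x∈⁅y⁆⇒x≡y j i∈⁅j⁆)) w

  complete-of-vetoer : ∀ {i} → Vetoer G i → OthersInterchangeable i → Complete G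
  complete-of-vetoer {i} veto others j k with j ≟ i | k ≟ i
  ... | yes refl | _        = inj₁ (vetoer⇒≿ veto k)
  ... | no _     | yes refl = inj₂ (vetoer⇒≿ veto j)
  ... | no j≢i   | no k≢i   = inj₁ (others j k j≢i k≢i)

  ≉-others⇒hasTypes-2 : ∀ i → (∃ λ j → j ≢ i) → (∀ j → j ≢ i → ¬ _≈_ G i j) → OthersInterchangeable i →
               HasTypes G 2
  ≉-others⇒hasTypes-2 i (j₀ , j₀≢i) i≉ others = type , onto , kernel
    where
    type : Fin n → Fin 2
    type x with x ≟ i
    ... | yes _ = zero
    ... | no _  = suc zero
    type-i : type i ≡ zero
    type-i with i ≟ i
    ... | yes _   = refl
    ... | no i≢i = contradiction refl i≢i
    type-other : ∀ {x} → x ≢ i → type x ≡ suc zero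
    type-other {x} x≢i with x ≟ i
    ... | yes x≡i = contradiction x≡i x≢i
    ... | no _    = refl
    onto : ∀ t → ∃ λ x → type x ≡ t
    onto zero       = i , type-i
    onto (suc zero) = j₀ , type-other j₀≢i
    kernel : ∀ x y → (type x ≡ type y) ⇔ _≈_ G x y
    kernel x y with x ≟ i | y ≟ i
    ... | yes refl | yes refl = mk⇔ (λ _ → ≈-refl x) (λ _ → refl)
    ... | yes refl | no y≢i   = mk⇔ (λ ()) (λ x≈y → contradiction x≈y (i≉ y y≢i))
    ... | no x≢i   | yes refl = mk⇔ (λ ()) (λ x≈y → contradiction (≈-sym x≈y) (i≉ x x≢i))
    ... | no x≢i   | no y≢i   =
      mk⇔ (λ _ → ≿-antisym (others x y x≢i y≢i) (others y x y≢i x≢i)) (λ _ → refl)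

all≈⇒hasTypes-1 : ∀ {m} (G : Game (suc m)) → (∀ i j → _≈_ G i j) → HasTypes G 1
all≈⇒hasTypes-1 G all≈ =
  (λ _ → zero) , (λ { zero → zero , refl }) , λ i j → mk⇔ (λ _ → all≈ i j) (λ _ → refl)

hasTypes-unique : ∀ {n} (G : Game n) {t u} → HasTypes G t → HasTypes G u → t ≡ u
hasTypes-unique G (f , f-onto , f-kernel) (g , g-onto , g-kernel) =
  surjections-same-kernel⇒≡ f g f-onto g-onto λ i j →
    mk⇔ (from (g-kernel i j) ∘ to (f-kernel i j)) (from (f-kernel i j) ∘ to (g-kernel i j))

module VetoPairGame {n : ℕ} {G : Game n} {i : Fin n} (vp : IsVetoPairGame G i) where

  winning : ∀ {S j} → i ∈ S → j ≢ i → j ∈ S → Winning G S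
  winning i∈S j≢i j∈S = from (vp _) (i∈S , _ , j≢i , j∈S)

  vetoer : Vetoer G i
  vetoer S w = proj₁ (to (vp S) w)

  upClosed : UpClosed G
  upClosed S T S⊆T w with to (vp S) w
  ... | i∈S , j , j≢i , j∈S = winning (S⊆T i∈S) j≢i (S⊆T j∈S)

  noWinningSingleton : ∀ x → ¬ Winning G ⁅ x ⁆
  noWinningSingleton x w with to (vp _) w
  ... | i∈⁅x⁆ , j , j≢i , j∈⁅x⁆ = j≢i (trans (x∈⁅y⁆⇒x≡y x j∈⁅x⁆) (sym (x∈⁅y⁆⇒x≡y x i∈⁅x⁆)))

  semiPasser : SemiPasser G i
  semiPasser = noWinningSingleton i , λ j j≢i → winning (i∈⁅i⁆∪⁅j⁆ i j) j≢i (j∈⁅i⁆∪⁅j⁆ i j)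

  othersInterchangeable : OthersInterchangeable G i
  othersInterchangeable j k j≢i k≢i S j∉S k∉S w with x∈p∪q⁻ S ⁅ k ⁆ (vetoer _ w)
  ... | inj₁ i∈S   = winning (p⊆p∪q ⁅ j ⁆ i∈S) j≢i (q⊆p∪q S ⁅ j ⁆ (x∈⁅x⁆ j))
  ... | inj₂ i∈⁅k⁆ = contradiction (sym (x∈⁅y⁆⇒x≡y k i∈⁅k⁆)) k≢i

  isCGVSP : (∃ λ j → j ≢ i) → IsCGVSP G
  isCGVSP (j , j≢i) = (winning ∈⊤ j≢i ∈⊤ , (λ w → ∉⊥ (vetoer ⊥ w)) , upClosed)
                    , complete-of-vetoer G vetoer othersInterchangeable
                    , (i , vetoer) , (i , semiPasser)

  -- A third player k separates i from j: {k, i} wins, {k, j} does not.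
  ≉-others : ∀ {j} → j ≢ i → (∃ λ k → k ≢ i × k ≢ j) → ¬ _≈_ G i j
  ≉-others {j} j≢i (k , k≢i , k≢j) i≈j =
    [ i∉⁅k⁆ , x≢y⇒x∉⁅y⁆ (j≢i ∘ sym) ]′ (x∈p∪q⁻ ⁅ k ⁆ ⁅ j ⁆ (vetoer _ kj-wins))
    where
    i∉⁅k⁆ : i ∉ ⁅ k ⁆
    i∉⁅k⁆ = x≢y⇒x∉⁅y⁆ (k≢i ∘ sym)
    kj-wins : Winning G (⁅ k ⁆ ∪ ⁅ j ⁆)
    kj-wins = to (i≈j ⁅ k ⁆ i∉⁅k⁆ (x≢y⇒x∉⁅y⁆ (k≢j ∘ sym))) (winning (j∈⁅i⁆∪⁅j⁆ k i) k≢i (i∈⁅i⁆∪⁅j⁆ k i))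

-- With two players, a coalition avoiding both i and j is empty.
vetoPairGame₂-≈ : ∀ {G : Game 2} {i j} → IsVetoPairGame G i → j ≢ i → _≈_ G i j
vetoPairGame₂-≈ {G} {i} {j} vp j≢i S i∉S j∉S = mk⇔ (⊥-elim ∘ Si-loses) (⊥-elim ∘ Sj-loses)
  where
  open VetoPairGame vp
  Si-loses : ¬ Winning G (S ∪ ⁅ i ⁆)
  Si-loses w with to (vp _) w
  ... | _ , x , x≢i , x∈S∪⁅i⁆ with x∈p∪q⁻ S ⁅ i ⁆ x∈S∪⁅i⁆
  ...   | inj₁ x∈S   = j∉S (subst (_∈ S) (Fin2-≢-unique x≢i j≢i) x∈S)
  ...   | inj₂ x∈⁅i⁆ = x≢i (x∈⁅y⁆⇒x≡y i x∈⁅i⁆)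
  Sj-loses : ¬ Winning G (S ∪ ⁅ j ⁆)
  Sj-loses w with x∈p∪q⁻ S ⁅ j ⁆ (vetoer _ w)
  ... | inj₁ i∈S   = i∉S i∈S
  ... | inj₂ i∈⁅j⁆ = j≢i (sym (x∈⁅y⁆⇒x≡y j i∈⁅j⁆))

vetoPairGame₂-hasTypes-1 : ∀ {G : Game 2} {i} → IsVetoPairGame G i → HasTypes G 1
vetoPairGame₂-hasTypes-1 {G} {i} vp = all≈⇒hasTypes-1 G all≈
  where
  all≈ : ∀ x y → _≈_ G x y
  all≈ x y with x ≟ i | y ≟ i
  ... | yes refl | yes refl = ≈-refl G x
  ... | yes refl | no y≢i   = vetoPairGame₂-≈ vp y≢i
  ... | no x≢i   | yes refl = ≈-sym G (vetoPairGame₂-≈ vp x≢i)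
  ... | no x≢i   | no y≢i   = subst (_≈_ G x) (Fin2-≢-unique x≢i y≢i) (≈-refl G x)

vetoPairGame≥3-hasTypes-2 : ∀ {m} {G : Game (3 + m)} {i} → IsVetoPairGame G i → HasTypes G 2
vetoPairGame≥3-hasTypes-2 {G = G} {i} vp =
  ≉-others⇒hasTypes-2 G i (another i) (λ j j≢i → ≉-others j≢i (aThird i j)) othersInterchangeable
  where open VetoPairGame vp

module Dictatorship {n : ℕ} {G : Game n} {i : Fin n} (dict : IsDictatorship G i) where

  vetoer : Vetoer G i
  vetoer S = to (dict S)

  isSimpleGame : IsSimpleGame G
  isSimpleGame = from (dict ⊤) ∈⊤ , (λ w → ∉⊥ (vetoer ⊥ w))
               , λ S T S⊆T w → from (dict T) (S⊆T (vetoer S w))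

  othersInterchangeable : OthersInterchangeable G i
  othersInterchangeable j k j≢i k≢i S j∉S k∉S w with x∈p∪q⁻ S ⁅ k ⁆ (vetoer _ w)
  ... | inj₁ i∈S   = from (dict _) (p⊆p∪q ⁅ j ⁆ i∈S)
  ... | inj₂ i∈⁅k⁆ = contradiction (sym (x∈⁅y⁆⇒x≡y k i∈⁅k⁆)) k≢i

  ≉-others : ∀ {j} → j ≢ i → ¬ _≈_ G i j
  ≉-others {j} j≢i i≈j =
    [ ∉⊥ , x≢y⇒x∉⁅y⁆ (j≢i ∘ sym) ]′ (x∈p∪q⁻ ⊥ ⁅ j ⁆ (vetoer _ (to (i≈j ⊥ ∉⊥ ∉⊥) ⁅i⁆-wins)))
    where
    ⁅i⁆-wins : Winning G (⊥ ∪ ⁅ i ⁆)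
    ⁅i⁆-wins = from (dict _) (q⊆p∪q ⊥ ⁅ i ⁆ (x∈⁅x⁆ i))

  hasTypes-2 : (∃ λ j → j ≢ i) → HasTypes G 2
  hasTypes-2 other = ≉-others⇒hasTypes-2 G i other (λ j → ≉-others) othersInterchangeable

isDictatorship⇒isCGVSP₂ : ∀ {G : Game 2} {i} → IsDictatorship G i → IsCGVSP G
isDictatorship⇒isCGVSP₂ {G} {i} dict =
  isSimpleGame , complete-of-vetoer G vetoer othersInterchangeable , (i , vetoer) , (j , semiPasser)
  where
  open Dictatorship dict
  j = proj₁ (another i)
  j≢i = proj₂ (another i)
  semiPasser : SemiPasser G j
  semiPasser = (λ w → j≢i (sym (x∈⁅y⁆⇒x≡y j (vetoer _ w))))
             , λ k k≢j → from (dict _) (subst (_∈ ⁅ j ⁆ ∪ ⁅ k ⁆) (Fin2-≢-unique k≢j (j≢i ∘ sym))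
                                                  (j∈⁅i⁆∪⁅j⁆ j k))

∈-image : ∀ {n} (σ : Permutation′ n) S x → x ∈ image σ S ⇔ σ ⟨$⟩ʳ x ∈ S
∈-image σ S x = mk⇔ (λ p → lookup⇒[]= _ S (trans (sym (lookup∘tabulate _ x)) ([]=⇒lookup p)))
                    (λ p → lookup⇒[]= x _ (trans (lookup∘tabulate _ x) ([]=⇒lookup p)))

image-flip : ∀ {n} (σ : Permutation′ n) S → image σ (image (flip σ) S) ≡ S
image-flip σ S = begin
  tabulate (λ x → lookup (image (flip σ) S) (σ ⟨$⟩ʳ x))
    ≡⟨ tabulate-cong (λ x → trans (lookup∘tabulate _ (σ ⟨$⟩ʳ x)) (cong (lookup S) (inverseˡ σ))) ⟩
  tabulate (lookup S)
    ≡⟨ tabulate∘lookup S ⟩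
  S ∎
  where open ≡-Reasoning

Iso-sym : ∀ {n} {G H : Game n} → Iso G H → Iso H G
Iso-sym {H = H} (σ , G≡H∘σ) =
  flip σ , λ S → trans (cong H (sym (image-flip σ S))) (sym (G≡H∘σ (image (flip σ) S)))

Iso-from-⇔ : ∀ {n} {G H : Game n} (σ : Permutation′ n) →
             (∀ S → Winning G S ⇔ Winning H (image σ S)) → Iso G H
Iso-from-⇔ σ G⇔H∘σ = σ , λ S → ⇔→≡ (G⇔H∘σ S)

⟨$⟩ʳ-injective : ∀ {n} (σ : Permutation′ n) {x y} → σ ⟨$⟩ʳ x ≡ σ ⟨$⟩ʳ y → x ≡ y
⟨$⟩ʳ-injective σ σx≡σy = trans (sym (inverseˡ σ)) (trans (cong (σ ⟨$⟩ˡ_) σx≡σy) (inverseˡ σ))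

transpose-k≡i : ∀ {n} (k i : Fin n) → transpose k i ⟨$⟩ʳ k ≡ i
transpose-k≡i k i rewrite dec-true (k ≟ k) refl = refl

∈-image-transpose : ∀ {n} (k i : Fin n) S → k ∈ image (transpose k i) S ⇔ i ∈ S
∈-image-transpose k i S =
  subst (λ x → k ∈ image (transpose k i) S ⇔ x ∈ S) (transpose-k≡i k i) (∈-image (transpose k i) S k)

vetoPairGame-Iso : ∀ {n} {G H : Game n} {i k} → IsVetoPairGame G i → IsVetoPairGame H k → Iso G H
vetoPairGame-Iso {G = G} {H} {i} {k} vpG vpH = Iso-from-⇔ {G = G} {H} σ λ S → mk⇔ (forth S) (back S)
  where
  σ = transpose k i
  σk≡i : σ ⟨$⟩ʳ k ≡ i
  σk≡i = transpose-k≡i k i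
  forth : ∀ S → Winning G S → Winning H (image σ S)
  forth S w with to (vpG S) w
  ... | i∈S , j , j≢i , j∈S =
    from (vpH _) ( from (∈-image-transpose k i S) i∈S
                 , σ ⟨$⟩ˡ j
                 , (λ σ⁻¹j≡k → j≢i (trans (sym (inverseʳ σ)) (trans (cong (σ ⟨$⟩ʳ_) σ⁻¹j≡k) σk≡i)))
                 , from (∈-image σ S _) (subst (_∈ S) (sym (inverseʳ σ)) j∈S))
  back : ∀ S → Winning H (image σ S) → Winning G S
  back S w with to (vpH _) w
  ... | k∈σS , j , j≢k , j∈σS =
    from (vpG S) ( to (∈-image-transpose k i S) k∈σS
                 , σ ⟨$⟩ʳ j
                 , (λ σj≡i → j≢k (⟨$⟩ʳ-injective σ (trans σj≡i (sym σk≡i))))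
                 , to (∈-image σ S j) j∈σS)

dictatorship-Iso : ∀ {n} {G H : Game n} {i k} → IsDictatorship G i → IsDictatorship H k → Iso G H
dictatorship-Iso {G = G} {H} {i} {k} dG dH = Iso-from-⇔ {G = G} {H} (transpose k i) λ S →
  mk⇔ (λ w → from (dH _) (from (∈-image-transpose k i S) (to (dG S) w)))
      (λ w → from (dG S) (to (∈-image-transpose k i S) (to (dH _) w)))

-- The singleton of the preimage of the dictator would have to win.
vetoPairGame-≇-dictatorship : ∀ {n} {G H : Game n} {i k} → IsVetoPairGame G i → IsDictatorship H k → ¬ Iso G H
vetoPairGame-≇-dictatorship {k = k} vp dict (σ , G≡H∘σ) =
  noWinningSingleton (σ ⟨$⟩ʳ k) (trans (G≡H∘σ _) (from (dict _) (from (∈-image σ _ k) (x∈⁅x⁆ _))))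
  where open VetoPairGame vp

vetoer≡semiPasser : ∀ {m} {G : Game (3 + m)} {i j} → Vetoer G i → SemiPasser G j → i ≡ j
vetoer≡semiPasser {i = i} {j} veto (_ , pairs) with aThird j i
... | k , k≢j , k≢i with x∈p∪q⁻ ⁅ j ⁆ ⁅ k ⁆ (veto _ (pairs k k≢j))
...   | inj₁ i∈⁅j⁆ = x∈⁅y⁆⇒x≡y j i∈⁅j⁆
...   | inj₂ i∈⁅k⁆ = contradiction (sym (x∈⁅y⁆⇒x≡y k i∈⁅k⁆)) k≢i

module _ {n : ℕ} {G : Game n} (upClosed : UpClosed G) {i : Fin n} (veto : Vetoer G i) where

  vetoer-semiPasser⇒IsVetoPairGame : SemiPasser G i → IsVetoPairGame G i
  vetoer-semiPasser⇒IsVetoPairGame (⁅i⁆-loses , pairs-win) S = mk⇔ forth back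
    where
    forth : Winning G S → i ∈ S × ∃ λ j → j ≢ i × j ∈ S
    forth w with partner? i S
    ... | yes other = veto S w , other
    ... | no none   = contradiction (upClosed S ⁅ i ⁆ S⊆⁅i⁆ w) ⁅i⁆-loses
      where
      S⊆⁅i⁆ : S ⊆ ⁅ i ⁆
      S⊆⁅i⁆ {x} x∈S with x ≟ i
      ... | yes refl = x∈⁅x⁆ x
      ... | no x≢i   = contradiction (x , x≢i , x∈S) none
    back : i ∈ S × (∃ λ j → j ≢ i × j ∈ S) → Winning G S
    back (i∈S , j , j≢i , j∈S) = upClosed _ S (⁅⁆∪⁅⁆⊆ i∈S j∈S) (pairs-win j j≢i)

  vetoer-winningSingleton⇒IsDictatorship : Winning G ⁅ i ⁆ → IsDictatorship G i
  vetoer-winningSingleton⇒IsDictatorship ⁅i⁆-wins S =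
    mk⇔ (veto S) (λ i∈S → upClosed ⁅ i ⁆ S (⁅⁆⊆ i∈S) ⁅i⁆-wins)

semiPasser₂ : ∀ {G : Game 2} {i} → UpClosed G → Winning G ⊤ → ¬ Winning G ⁅ i ⁆ → SemiPasser G i
semiPasser₂ {i = i} upClosed ⊤-wins ⁅i⁆-loses = ⁅i⁆-loses , λ j j≢i → upClosed ⊤ _ (⊤⊆⁅i⁆∪⁅j⁆ j≢i) ⊤-wins
  where
  ⊤⊆⁅i⁆∪⁅j⁆ : ∀ {j} → j ≢ i → ⊤ ⊆ ⁅ i ⁆ ∪ ⁅ j ⁆
  ⊤⊆⁅i⁆∪⁅j⁆ {j} j≢i {x} _ with x ≟ i
  ... | yes refl = i∈⁅i⁆∪⁅j⁆ x j
  ... | no x≢i   = subst (_∈ ⁅ i ⁆ ∪ ⁅ j ⁆) (Fin2-≢-unique j≢i x≢i) (j∈⁅i⁆∪⁅j⁆ i j)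

¬cgvsp₁ : ∀ (G : Game 1) → ¬ IsCGVSP G
¬cgvsp₁ G ((⊤-wins , _) , _ , _ , (zero , ⁅0⁆-loses , _)) = ⁅0⁆-loses ⊤-wins

cgvsp₂-cases : ∀ {G : Game 2} → IsCGVSP G → (∃ λ i → IsVetoPairGame G i) ⊎ (∃ λ i → IsDictatorship G i)
cgvsp₂-cases {G} ((⊤-wins , _ , upClosed) , _ , (i , veto) , _) with G ⁅ i ⁆ ≟ᵇ true
... | yes ⁅i⁆-wins = inj₂ (i , vetoer-winningSingleton⇒IsDictatorship upClosed veto ⁅i⁆-wins)
... | no ⁅i⁆-loses =
  inj₁ (i , vetoer-semiPasser⇒IsVetoPairGame upClosed veto (semiPasser₂ upClosed ⊤-wins ⁅i⁆-loses))

cgvsp≥3⇒vetoPairGame : ∀ {m} {G : Game (3 + m)} → IsCGVSP G → ∃ λ i → IsVetoPairGame G i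
cgvsp≥3⇒vetoPairGame {G = G} ((_ , _ , upClosed) , _ , (i , veto) , (j , semi)) =
  i , vetoer-semiPasser⇒IsVetoPairGame upClosed veto
        (subst (SemiPasser G) (sym (vetoer≡semiPasser veto semi)) semi)

vetoPairGame : ∀ {n} → Fin n → Game n
vetoPairGame i S = does ((i ∈? S) ×-dec partner? i S)

vetoPairGame-isVetoPairGame : ∀ {n} (i : Fin n) → IsVetoPairGame (vetoPairGame i) i
vetoPairGame-isVetoPairGame i S = does≡true⇔ ((i ∈? S) ×-dec partner? i S)

dictatorship : ∀ {n} → Fin n → Game n
dictatorship i S = does (i ∈? S)

dictatorship-isDictatorship : ∀ {n} (i : Fin n) → IsDictatorship (dictatorship i) i
dictatorship-isDictatorship i S = does≡true⇔ (i ∈? S)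

noIsoClasses : ∀ {n} {P : Game n → Set} → (∀ G → ¬ P G) → NumIsoClasses n P 0
noIsoClasses none = [] , [] , (λ ()) , λ G p → contradiction p (none G)

oneIsoClass : ∀ {n} {P : Game n → Set} {G₀} → P G₀ → (∀ G → P G → Iso G G₀) → NumIsoClasses n P 1
oneIsoClass {G₀ = G₀} p₀ iso =
  G₀ ∷ [] , p₀ ∷ [] , (λ { zero zero 0≢0 → contradiction refl 0≢0 }) , λ G p → zero , iso G p

unanimity₂ : Game 2
unanimity₂ = vetoPairGame zero

unanimity₂-isCGVSP : IsCGVSP unanimity₂
unanimity₂-isCGVSP = VetoPairGame.isCGVSP (vetoPairGame-isVetoPairGame zero) (another zero)

unanimity₂-hasTypes-1 : HasTypes unanimity₂ 1
unanimity₂-hasTypes-1 = vetoPairGame₂-hasTypes-1 (vetoPairGame-isVetoPairGame zero)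

dictatorship₂ : Game 2
dictatorship₂ = dictatorship zero

dictatorship₂-isCGVSP : IsCGVSP dictatorship₂
dictatorship₂-isCGVSP = isDictatorship⇒isCGVSP₂ (dictatorship-isDictatorship zero)

dictatorship₂-hasTypes-2 : HasTypes dictatorship₂ 2
dictatorship₂-hasTypes-2 = Dictatorship.hasTypes-2 (dictatorship-isDictatorship zero) (another zero)

cgvsp₂-classify : ∀ {G : Game 2} → IsCGVSP G →
                  (Iso G unanimity₂ × HasTypes G 1) ⊎ (Iso G dictatorship₂ × HasTypes G 2)
cgvsp₂-classify c with cgvsp₂-cases c
... | inj₁ (_ , vp) =
  inj₁ (vetoPairGame-Iso vp (vetoPairGame-isVetoPairGame zero) , vetoPairGame₂-hasTypes-1 vp)
... | inj₂ (i , dict) =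
  inj₂ (dictatorship-Iso dict (dictatorship-isDictatorship zero) , Dictatorship.hasTypes-2 dict (another i))

cgvsp-two-players : NumIsoClasses 2 IsCGVSP 2
cgvsp-two-players = representatives , unanimity₂-isCGVSP ∷ dictatorship₂-isCGVSP ∷ [] , distinct , cover
  where
  representatives : Vec (Game 2) 2
  representatives = unanimity₂ ∷ dictatorship₂ ∷ []
  U≇D : ¬ Iso unanimity₂ dictatorship₂
  U≇D = vetoPairGame-≇-dictatorship (vetoPairGame-isVetoPairGame zero) (dictatorship-isDictatorship zero)
  distinct : ∀ a b → a ≢ b → ¬ Iso (lookup representatives a) (lookup representatives b)
  distinct zero       zero       a≢a = contradiction refl a≢a
  distinct zero       (suc zero) _   = U≇D
  distinct (suc zero) zero       _   = U≇D ∘ Iso-sym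
  distinct (suc zero) (suc zero) a≢a = contradiction refl a≢a
  cover : ∀ G → IsCGVSP G → ∃ λ a → Iso G (lookup representatives a)
  cover G c with cgvsp₂-classify c
  ... | inj₁ (iso , _) = zero , iso
  ... | inj₂ (iso , _) = suc zero , iso

cgvsp-two-players-types : ∀ t → NumIsoClasses 2 (λ G → IsCGVSP G × HasTypes G t) (cgvspT 2 t)
cgvsp-two-players-types zero = noIsoClasses λ { G (_ , f , _) → ¬Fin0 (f zero) }
cgvsp-two-players-types (suc zero) = oneIsoClass (unanimity₂-isCGVSP , unanimity₂-hasTypes-1) cover
  where
  cover : ∀ G → IsCGVSP G × HasTypes G 1 → Iso G unanimity₂
  cover G (c , ty) with cgvsp₂-classify c
  ... | inj₁ (iso , _) = iso
  ... | inj₂ (_ , ty₂) = contradiction (hasTypes-unique G ty ty₂) λ ()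
cgvsp-two-players-types (suc (suc zero)) = oneIsoClass (dictatorship₂-isCGVSP , dictatorship₂-hasTypes-2) cover
  where
  cover : ∀ G → IsCGVSP G × HasTypes G 2 → Iso G dictatorship₂
  cover G (c , ty) with cgvsp₂-classify c
  ... | inj₁ (_ , ty₁) = contradiction (hasTypes-unique G ty ty₁) λ ()
  ... | inj₂ (iso , _) = iso
cgvsp-two-players-types (suc (suc (suc t))) = noIsoClasses none
  where
  none : ∀ G → ¬ (IsCGVSP G × HasTypes G (3 + t))
  none G (c , ty) with cgvsp₂-classify c
  ... | inj₁ (_ , ty₁) = contradiction (hasTypes-unique G ty ty₁) λ ()
  ... | inj₂ (_ , ty₂) = contradiction (hasTypes-unique G ty ty₂) λ ()

module _ (m : ℕ) where

  private
    vetoPairGame₀ : Game (3 + m)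
    vetoPairGame₀ = vetoPairGame zero

    vetoPairGame₀-isCGVSP : IsCGVSP vetoPairGame₀
    vetoPairGame₀-isCGVSP = VetoPairGame.isCGVSP (vetoPairGame-isVetoPairGame zero) (another zero)

    cgvsp⇒Iso : ∀ G → IsCGVSP G → Iso G vetoPairGame₀
    cgvsp⇒Iso G c =
      vetoPairGame-Iso (proj₂ (cgvsp≥3⇒vetoPairGame {m} c)) (vetoPairGame-isVetoPairGame zero)

    cgvsp⇒hasTypes-2 : ∀ G → IsCGVSP G → HasTypes G 2
    cgvsp⇒hasTypes-2 G c = vetoPairGame≥3-hasTypes-2 {m} (proj₂ (cgvsp≥3⇒vetoPairGame {m} c))

    noTypes : ∀ {t} → t ≢ 2 → ∀ G → ¬ (IsCGVSP G × HasTypes G t)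
    noTypes t≢2 G (c , ty) = t≢2 (hasTypes-unique G ty (cgvsp⇒hasTypes-2 G c))

  cgvsp-many-players : NumIsoClasses (3 + m) IsCGVSP 1
  cgvsp-many-players = oneIsoClass vetoPairGame₀-isCGVSP cgvsp⇒Iso

  cgvsp-many-players-types : ∀ t →
    NumIsoClasses (3 + m) (λ G → IsCGVSP G × HasTypes G t) (cgvspT (3 + m) t)
  cgvsp-many-players-types zero                = noIsoClasses (noTypes λ ())
  cgvsp-many-players-types (suc zero)          = noIsoClasses (noTypes λ ())
  cgvsp-many-players-types (suc (suc zero))    =
    oneIsoClass (vetoPairGame₀-isCGVSP , cgvsp⇒hasTypes-2 _ vetoPairGame₀-isCGVSP)
                λ G → cgvsp⇒Iso G ∘ proj₁
  cgvsp-many-players-types (suc (suc (suc t))) = noIsoClasses (noTypes λ ())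

lemmaL : ∀ (n : ℕ) → n ≥ 1 →
           NumIsoClasses n IsCGVSP (cgvsp n)
           × (∀ (t : ℕ) → NumIsoClasses n (λ G → IsCGVSP G × HasTypes G t) (cgvspT n t))
lemmaL zero ()
lemmaL (suc zero) _ = noIsoClasses ¬cgvsp₁ , λ t → noIsoClasses λ G → ¬cgvsp₁ G ∘ proj₁
lemmaL (suc (suc zero)) _ = cgvsp-two-players , cgvsp-two-players-types
lemmaL (suc (suc (suc m))) _ = cgvsp-many-players m , cgvsp-many-players-types m
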